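{- Let $\mathbb{C}$ be a category with pullbacks, and let $\mathbb{D}$ be a double square approach in $\mathbb{C}$ that is pullback stable and sound with respect to colimit decomposition. Let $L\xleftarrow{a}K\xrightarrow{b}R$, $X\xleftarrow{c}Y\xrightarrow{d}Z$, $m\colon L\to X$, $j\colon K\to Y$, $n\colon R\to Z$ be a double square diagram belonging to $\mathbb{D}$. Let $\mathbb{J}$ be a category and $\mathcal{X}\colon\mathbb{J}\to\mathbb{C}$ a functor with colimit $\xi\colon\mathcal{X}\to\Delta X$. Suppose there exist a cospan $X\xrightarrow{w}U\xleftarrow{t}Z$ with $w\circ c=t\circ d$, and a functor $\mathcal{U}\colon\mathbb{J}\to\mathbb{C}$ with a pullback stable colimit $\varphi\colon\mathcal{U}\to\Delta U$, such that $\xi$ is the pullback of $\varphi$ along $w$, i.e. there is a natural transformation $\omega\colon\mathcal{X}\to\mathcal{U}$ such that for every $i\in\mathbb{J}$ the square $\mathcal{U}_i\xleftarrow{\omega_i}\mathcal{X}_i\xrightarrow{\xi_i}X$ is a pullback of $\mathcal{U}_i\xrightarrow{\varphi_i}U\xleftarrow{w}X$. Then the local $\mathbb{J}$-decomposition problem $\langle\xi,(L\xleftarrow{a}K\xrightarrow{b}R),m\rangle$ has a solution.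
   Context: A double square diagram in $\mathbb{C}$: objects $L,K,R,X,Y,Z$ and morphisms $a\colon K\to L$, $b\colon K\to R$, $c\colon Y\to X$, $d\colon Y\to Z$, $m\colon L\to X$, $j\colon K\to Y$, $n\colon R\to Z$ with $m\circ a=c\circ j$, $n\circ b=d\circ j$. A double square transformation approach in $\mathbb{C}$ is any collection $\mathbb{D}$ of commutative double square diagrams in $\mathbb{C}$. A rule is a span $L\xleftarrow{a}K\xrightarrow{b}R$; a morphism $m\colon L\to X$ is a match for it if some diagram in $\mathbb{D}$ has top row $L\xleftarrow{a}K\xrightarrow{b}R$ and left vertical morphism $m$. Colimit notation: $\Delta D$ is the constant functor at $D$; a colimit of $\mathcal{D}\colon\mathbb{J}\to\mathbb{C}$ is a universal cocone $\mathcal{D}\to\Delta D$ with object $\operatorname{col}\mathcal{D}$; for colimits of $\mathcal{D},\mathcal{E}$ and $\tau\colon\mathcal{D}\to\mathcal{E}$, $\operatorname{col}\tau$ is the induced morphism between colimit objects. A natural transformation $\tau\colon\mathcal{H}\to\mathcal{L}$ is cartesian if all its naturality squares are pullbacks. A colimit $\lambda\colon\mathcal{L}\to\Delta L$ is pullback stable if for every cartesian $\tau\colon\mathcal{H}\to\mathcal{L}$, every cocone $\varphi\colon\mathcal{H}\to\Delta H$ and every $t\colon H\to L$ such that for all $i$ the square $\lambda_i\circ\tau_i=t\circ\varphi_i$ is a pullback, the cocone $\varphi$ is a colimit of $\mathcal{H}$. $\mathbb{D}$ is sound w.r.t. colimit decomposition if for every category $\mathbb{J}$ and every commutative double square diagram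 in $[\mathbb{J},\mathbb{C}]$ whose component at each $i\in\mathbb{J}$ belongs to $\mathbb{D}$ and whose six functors have colimits, the induced diagram of colimit objects and induced morphisms $\operatorname{col}(-)$ belongs to $\mathbb{D}$. A pullback lifting of a double square diagram $D\in\mathbb{D}$ (objects $L,K,R,X,Y,Z$) is a double square diagram $D'$ (objects $L',K',R',X',Y',Z'$) together with morphisms $\psi_L\colon L'\to L,\dots,\psi_Z\colon Z'\to Z$ forming a transformation $D'\to D$ all of whose seven squares (one for each arrow of the double square) are pullbacks. $\mathbb{D}$ is pullback stable if every pullback lifting of a diagram in $\mathbb{D}$ belongs to $\mathbb{D}$. A local $\mathbb{J}$-decomposition problem is a triple $\langle\xi,q,m\rangle$ with $\xi\colon\mathcal{X}\to\Delta X$ a colimit of $\mathcal{X}\colon\mathbb{J}\to\mathbb{C}$, $q=(L\xleftarrow{a}K\xrightarrow{b}R)$ a rule and $m\colon L\to X$ a match. A solution is a pair $\langle\mu,\mathcal{Q}\rangle$ where $\mathcal{Q}=(\mathcal{L}\xleftarrow{\alpha}\mathcal{K}\xrightarrow{\beta}\mathcal{R})$ is a span in $[\mathbb{J},\mathbb{C}]$ and $\mu\colon\mathcal{L}\to\mathcal{X}$ a natural transformation such that (i) $m=\operatorname{col}\mu$, $a=\operatorname{col}\alpha$, $b=\operatorname{col}\beta$ for suitable choices of colimits of $\mathcal{L},\mathcal{K},\mathcal{R}$ (with $\xi$ the colimit of $\mathcal{X}$); (ii) there are functors $\mathcal{Y},\mathcal{Z}$ having colimits and natural transformations $\gamma\colon\mathcal{Y}\to\mathcal{X}$,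 $\delta\colon\mathcal{Y}\to\mathcal{Z}$, $\iota\colon\mathcal{K}\to\mathcal{Y}$, $\nu\colon\mathcal{R}\to\mathcal{Z}$ with $\mu\circ\alpha=\gamma\circ\iota$, $\nu\circ\beta=\delta\circ\iota$, such that for each $i\in\mathbb{J}$ the component double square diagram ($\alpha_i,\beta_i,\gamma_i,\delta_i,\mu_i,\iota_i,\nu_i$) belongs to $\mathbb{D}$. -}

module Defs where

open import Level using (Level; _⊔_; Setω) renaming (suc to lsuc)
open import Relation.Binary.PropositionalEquality using (_≡_)
open import Data.Product using (Σ; Σ-syntax; _×_; ∃; ∃-syntax)

record Category (o ℓ : Level) : Set (lsuc (o ⊔ ℓ)) where
  infixr 9 _∘_
  infix 4 _⇒_
  field
    Obj       : Set o
    _⇒_       : Obj → Obj → Set ℓ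
    id        : ∀ {A} → A ⇒ A
    _∘_       : ∀ {A B C} → B ⇒ C → A ⇒ B → A ⇒ C
    identityˡ : ∀ {A B} {f : A ⇒ B} → id ∘ f ≡ f
    identityʳ : ∀ {A B} {f : A ⇒ B} → f ∘ id ≡ f
    assoc     : ∀ {A B C D} {f : A ⇒ B} {g : B ⇒ C} {h : C ⇒ D} →
                (h ∘ g) ∘ f ≡ h ∘ (g ∘ f)

record Functor {oj ℓj o ℓ : Level} (J : Category oj ℓj) (C : Category o ℓ)
       : Set (oj ⊔ ℓj ⊔ o ⊔ ℓ) where
  private
    module J = Category J
    module C = Category C
  field
    F₀           : J.Obj → C.Obj
    F₁           : ∀ {i j} → i J.⇒ j → F₀ i C.⇒ F₀ j
    identity     : ∀ {i} → F₁ (J.id {i}) ≡ C.id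
    homomorphism : ∀ {i j k} {f : i J.⇒ j} {g : j J.⇒ k} →
                   F₁ (g J.∘ f) ≡ F₁ g C.∘ F₁ f

record NatTrans {oj ℓj o ℓ : Level} {J : Category oj ℓj} {C : Category o ℓ}
       (F G : Functor J C) : Set (oj ⊔ ℓj ⊔ ℓ) where
  private
    module J = Category J
    module C = Category C
    module F = Functor F
    module G = Functor G
  field
    η       : ∀ i → F.F₀ i C.⇒ G.F₀ i
    commute : ∀ {i j} (f : i J.⇒ j) → G.F₁ f C.∘ η i ≡ η j C.∘ F.F₁ f

module _ {o ℓ : Level} (C : Category o ℓ) where
  open Category C

  IsPullback : ∀ {P A B Cc} → P ⇒ A → P ⇒ B → A ⇒ Cc → B ⇒ Cc → Set (o ⊔ ℓ)
  IsPullback {P} {A} {B} p₁ p₂ f g =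
    (f ∘ p₁ ≡ g ∘ p₂) ×
    (∀ {Q} (q₁ : Q ⇒ A) (q₂ : Q ⇒ B) → f ∘ q₁ ≡ g ∘ q₂ →
       Σ[ u ∈ Q ⇒ P ] ((p₁ ∘ u ≡ q₁) × (p₂ ∘ u ≡ q₂) ×
         (∀ (u' : Q ⇒ P) → p₁ ∘ u' ≡ q₁ → p₂ ∘ u' ≡ q₂ → u' ≡ u)))

  HasPullbacks : Set (o ⊔ ℓ)
  HasPullbacks = ∀ {A B Cc} (f : A ⇒ Cc) (g : B ⇒ Cc) →
    Σ[ P ∈ Obj ] Σ[ p₁ ∈ P ⇒ A ] Σ[ p₂ ∈ P ⇒ B ] IsPullback p₁ p₂ f g

module _ {oj ℓj o ℓ : Level} {J : Category oj ℓj} {C : Category o ℓ} where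
  private
    module J = Category J
  open Category C
  open Functor

  IsCocone : (F : Functor J C) (N : Obj) → (∀ i → F₀ F i ⇒ N) → Set (ℓj ⊔ oj ⊔ ℓ)
  IsCocone F N ψ = ∀ {i j} (f : i J.⇒ j) → ψ j ∘ F₁ F f ≡ ψ i

  IsColimit : (F : Functor J C) (N : Obj) → (∀ i → F₀ F i ⇒ N) →
              Set (oj ⊔ ℓj ⊔ o ⊔ ℓ)
  IsColimit F N ψ =
    IsCocone F N ψ ×
    (∀ (N' : Obj) (ψ' : ∀ i → F₀ F i ⇒ N') → IsCocone F N' ψ' →
       Σ[ h ∈ N ⇒ N' ] ((∀ i → h ∘ ψ i ≡ ψ' i) ×
         (∀ (h' : N ⇒ N') → (∀ i → h' ∘ ψ i ≡ ψ' i) → h' ≡ h)))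

  HasColimit : Functor J C → Set (oj ⊔ ℓj ⊔ o ⊔ ℓ)
  HasColimit F = Σ[ N ∈ Obj ] Σ[ ψ ∈ (∀ i → F₀ F i ⇒ N) ] IsColimit F N ψ

  -- h is the induced morphism col τ between the colimit objects
  -- (given colimits ψ : F → ΔN and χ : G → ΔM); by the universal property
  -- of ψ this characterises col τ uniquely.
  IsColMor : {F G : Functor J C} (τ : NatTrans F G)
             {N : Obj} (ψ : ∀ i → F₀ F i ⇒ N) {M : Obj} (χ : ∀ i → F₀ G i ⇒ M) →
             N ⇒ M → Set (oj ⊔ ℓ)
  IsColMor τ ψ χ h = ∀ i → h ∘ ψ i ≡ χ i ∘ NatTrans.η τ i

  Cartesian : {F G : Functor J C} → NatTrans F G → Set (oj ⊔ ℓj ⊔ o ⊔ ℓ)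
  Cartesian {F} {G} τ = ∀ {i j} (f : i J.⇒ j) →
    IsPullback C (F₁ F f) (NatTrans.η τ i) (NatTrans.η τ j) (F₁ G f)

  IsPullbackStableColimit : (F : Functor J C) (N : Obj) → (∀ i → F₀ F i ⇒ N) →
                            Set (oj ⊔ ℓj ⊔ o ⊔ ℓ)
  IsPullbackStableColimit F N λ' =
    IsColimit F N λ' ×
    (∀ (H : Functor J C) (τ : NatTrans H F) → Cartesian τ →
     ∀ (Hₒ : Obj) (φ : ∀ i → F₀ H i ⇒ Hₒ) → IsCocone H Hₒ φ →
     ∀ (t : Hₒ ⇒ N) →
     (∀ i → IsPullback C (φ i) (NatTrans.η τ i) t (λ' i)) →
     IsColimit H Hₒ φ)

module _ {o ℓ : Level} (C : Category o ℓ) where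
  open Category C

  -- Raw data of a double square diagram
  --   L <-a- K -b-> R
  --   m|     j|     |n
  --   X <-c- Y -d-> Z
  record DSq : Set (o ⊔ ℓ) where
    field
      L K R X Y Z : Obj
      a : K ⇒ L
      b : K ⇒ R
      c : Y ⇒ X
      d : Y ⇒ Z
      m : L ⇒ X
      j : K ⇒ Y
      n : R ⇒ Z

  Commutes : DSq → Set ℓ
  Commutes D = (m ∘ a ≡ c ∘ j) × (n ∘ b ≡ d ∘ j)
    where open DSq D

  record DSApproach (ℓd : Level) : Set (o ⊔ ℓ ⊔ lsuc ℓd) where
    field
      member      : DSq → Set ℓd
      commutative : ∀ D → member D → Commutes D

  record PullbackLifting (D' D : DSq) : Set (o ⊔ ℓ) where
    private
      module D' = DSq D'
      module D  = DSq D
    field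
      ψL : D'.L ⇒ D.L
      ψK : D'.K ⇒ D.K
      ψR : D'.R ⇒ D.R
      ψX : D'.X ⇒ D.X
      ψY : D'.Y ⇒ D.Y
      ψZ : D'.Z ⇒ D.Z
      pb-a : IsPullback C D'.a ψK ψL D.a
      pb-b : IsPullback C D'.b ψK ψR D.b
      pb-c : IsPullback C D'.c ψY ψX D.c
      pb-d : IsPullback C D'.d ψY ψZ D.d
      pb-m : IsPullback C D'.m ψL ψX D.m
      pb-j : IsPullback C D'.j ψK ψY D.j
      pb-n : IsPullback C D'.n ψR ψZ D.n

  module _ {ℓd : Level} (𝔻 : DSApproach ℓd) where
    open DSApproach 𝔻

    PullbackStable : Set (o ⊔ ℓ ⊔ ℓd)
    PullbackStable = ∀ (D' D : DSq) → Commutes D' → PullbackLifting D' D →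
                     member D → member D'

module _ {oj ℓj o ℓ : Level} (J : Category oj ℓj) (C : Category o ℓ) where
  open Category C
  open Functor
  open NatTrans

  record FunDSq : Set (oj ⊔ ℓj ⊔ o ⊔ ℓ) where
    field
      𝓛 𝓚 𝓡 𝓧 𝓨 𝓩 : Functor J C
      α : NatTrans 𝓚 𝓛
      β : NatTrans 𝓚 𝓡
      γ : NatTrans 𝓨 𝓧
      δ : NatTrans 𝓨 𝓩
      μ : NatTrans 𝓛 𝓧
      ι : NatTrans 𝓚 𝓨
      ν : NatTrans 𝓡 𝓩

    at : Category.Obj J → DSq C
    at i = record
      { L = F₀ 𝓛 i ; K = F₀ 𝓚 i ; R = F₀ 𝓡 i
      ; X = F₀ 𝓧 i ; Y = F₀ 𝓨 i ; Z = F₀ 𝓩 i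
      ; a = η α i ; b = η β i ; c = η γ i ; d = η δ i
      ; m = η μ i ; j = η ι i ; n = η ν i }

    FunCommutes : Set (oj ⊔ ℓ)
    FunCommutes = ∀ i → Commutes C (at i)

module _ {o ℓ : Level} {C : Category o ℓ} {ℓd : Level} where
  open Category C
  open Functor

  SoundColimitDecomposition : DSApproach C ℓd → Setω
  SoundColimitDecomposition 𝔻 =
    ∀ {oj ℓj} (J : Category oj ℓj) (F : FunDSq J C) →
    let open FunDSq F
        open DSApproach 𝔻 in
    FunCommutes →
    (∀ i → member (at i)) →
    ∀ (L K R X Y Z : Obj)
      (λL : ∀ i → F₀ 𝓛 i ⇒ L) (λK : ∀ i → F₀ 𝓚 i ⇒ K) (λR : ∀ i → F₀ 𝓡 i ⇒ R)
      (λX : ∀ i → F₀ 𝓧 i ⇒ X) (λY : ∀ i → F₀ 𝓨 i ⇒ Y) (λZ : ∀ i → F₀ 𝓩 i ⇒ Z) →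
    IsColimit 𝓛 L λL → IsColimit 𝓚 K λK → IsColimit 𝓡 R λR →
    IsColimit 𝓧 X λX → IsColimit 𝓨 Y λY → IsColimit 𝓩 Z λZ →
    ∀ (a : K ⇒ L) (b : K ⇒ R) (c : Y ⇒ X) (d : Y ⇒ Z)
      (m : L ⇒ X) (j : K ⇒ Y) (n : R ⇒ Z) →
    IsColMor α λK λL a → IsColMor β λK λR b →
    IsColMor γ λY λX c → IsColMor δ λY λZ d →
    IsColMor μ λL λX m → IsColMor ι λK λY j → IsColMor ν λR λZ n →
    member (record { L = L ; K = K ; R = R ; X = X ; Y = Y ; Z = Z
                   ; a = a ; b = b ; c = c ; d = d ; m = m ; j = j ; n = n })

module _ {oj ℓj o ℓ ℓd : Level} {J : Category oj ℓj} {C : Category o ℓ}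
         (𝔻 : DSApproach C ℓd) where
  open Category C
  open Functor
  open NatTrans
  open DSApproach 𝔻

  record Solution (𝓧 : Functor J C) {X : Obj} (ξ : ∀ i → F₀ 𝓧 i ⇒ X)
                  {L K R : Obj} (a : K ⇒ L) (b : K ⇒ R) (m : L ⇒ X)
                  : Set (oj ⊔ ℓj ⊔ o ⊔ ℓ ⊔ ℓd) where
    field
      𝓛 𝓚 𝓡 : Functor J C
      α : NatTrans 𝓚 𝓛
      β : NatTrans 𝓚 𝓡
      μ : NatTrans 𝓛 𝓧
      λL : ∀ i → F₀ 𝓛 i ⇒ L
      λK : ∀ i → F₀ 𝓚 i ⇒ K
      λR : ∀ i → F₀ 𝓡 i ⇒ R
      λL-colim : IsColimit 𝓛 L λL
      λK-colim : IsColimit 𝓚 K λK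
      λR-colim : IsColimit 𝓡 R λR
      m-col : IsColMor μ λL ξ m
      a-col : IsColMor α λK λL a
      b-col : IsColMor β λK λR b
      𝓨 𝓩 : Functor J C
      𝓨-colim : HasColimit 𝓨
      𝓩-colim : HasColimit 𝓩
      γ : NatTrans 𝓨 𝓧
      δ : NatTrans 𝓨 𝓩
      ι : NatTrans 𝓚 𝓨
      ν : NatTrans 𝓡 𝓩
      comm₁ : ∀ i → η μ i ∘ η α i ≡ η γ i ∘ η ι i
      comm₂ : ∀ i → η ν i ∘ η β i ≡ η δ i ∘ η ι i
      components : ∀ i → member (record
        { L = F₀ 𝓛 i ; K = F₀ 𝓚 i ; R = F₀ 𝓡 i
        ; X = F₀ 𝓧 i ; Y = F₀ 𝓨 i ; Z = F₀ 𝓩 i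
        ; a = η α i ; b = η β i ; c = η γ i ; d = η δ i
        ; m = η μ i ; j = η ι i ; n = η ν i })

module Submission where

-- Pull the whole situation back along the pullback-stable
-- colimit φ : 𝓤 → ΔU.  Every object A of the given double square D maps to U
-- (X by w, Z by t, the others by composing with the arrows of D); pulling
-- the cocone φ back along A → U yields a diagram 𝓐 : J → C with a cocone
-- 𝓐 → ΔA, a *restriction* of φ.  Pullback stability of φ makes this cocone a
-- colimit, and for X the restriction is the given colimit ξ itself.  Each
-- arrow of D lying over U induces a natural transformation between the
-- restrictions whose components are pullback squares (pullback pasting).  So
-- at every i ∈ J the restricted double square is a pullback lifting of D,
-- hence belongs to 𝔻, and the restrictions of L, K, R, Y, Z with the induced
-- transformations form the required solution.

open import Defs
open import Level using (Level; _⊔_)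
open import Relation.Binary.PropositionalEquality using (_≡_; refl; sym; trans; cong; module ≡-Reasoning)
open import Data.Product using (_,_; proj₁; proj₂)

module PullbackFacts {o ℓ : Level} (C : Category o ℓ) where
  open Category C
  open ≡-Reasoning

  pullˡ : ∀ {A B Cc D} {f : B ⇒ Cc} {g : A ⇒ B} {h : A ⇒ Cc} (k : D ⇒ A) →
          f ∘ g ≡ h → f ∘ (g ∘ k) ≡ h ∘ k
  pullˡ k e = trans (sym assoc) (cong (_∘ k) e)

  paste : ∀ {A₁ A₂ A₃ B₁ B₂ B₃} {p₁ : A₁ ⇒ B₁} {p₂ : A₂ ⇒ B₂} {p₃ : A₃ ⇒ B₃}
          {u : A₁ ⇒ A₂} {v : A₂ ⇒ A₃} {g : B₁ ⇒ B₂} {h : B₂ ⇒ B₃} →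
          p₃ ∘ v ≡ h ∘ p₂ → p₂ ∘ u ≡ g ∘ p₁ → p₃ ∘ (v ∘ u) ≡ (h ∘ g) ∘ p₁
  paste {p₁ = p₁} {u = u} {h = h} right left = begin
    _ ∘ (_ ∘ u)     ≡⟨ pullˡ u right ⟩
    (h ∘ _) ∘ u     ≡⟨ assoc ⟩
    h ∘ (_ ∘ u)     ≡⟨ cong (h ∘_) left ⟩
    h ∘ (_ ∘ p₁)    ≡⟨ sym assoc ⟩
    (h ∘ _) ∘ p₁    ∎

  module _ {P A B Cc} {p₁ : P ⇒ A} {p₂ : P ⇒ B} {f : A ⇒ Cc} {g : B ⇒ Cc}
           (pb : IsPullback C p₁ p₂ f g) where

    mediator : ∀ {Q} (q₁ : Q ⇒ A) (q₂ : Q ⇒ B) → f ∘ q₁ ≡ g ∘ q₂ → Q ⇒ P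
    mediator q₁ q₂ e = proj₁ (proj₂ pb q₁ q₂ e)

    mediator-p₁ : ∀ {Q} {q₁ : Q ⇒ A} {q₂ : Q ⇒ B} (e : f ∘ q₁ ≡ g ∘ q₂) →
                  p₁ ∘ mediator q₁ q₂ e ≡ q₁
    mediator-p₁ {q₁ = q₁} {q₂} e = proj₁ (proj₂ (proj₂ pb q₁ q₂ e))

    mediator-p₂ : ∀ {Q} {q₁ : Q ⇒ A} {q₂ : Q ⇒ B} (e : f ∘ q₁ ≡ g ∘ q₂) →
                  p₂ ∘ mediator q₁ q₂ e ≡ q₂
    mediator-p₂ {q₁ = q₁} {q₂} e = proj₁ (proj₂ (proj₂ (proj₂ pb q₁ q₂ e)))

    mediator-unique : ∀ {Q} {q₁ : Q ⇒ A} {q₂ : Q ⇒ B} (e : f ∘ q₁ ≡ g ∘ q₂)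
                      (u : Q ⇒ P) → p₁ ∘ u ≡ q₁ → p₂ ∘ u ≡ q₂ → u ≡ mediator q₁ q₂ e
    mediator-unique {q₁ = q₁} {q₂} e = proj₂ (proj₂ (proj₂ (proj₂ pb q₁ q₂ e)))

    jointly-monic : ∀ {Q} (u v : Q ⇒ P) → p₁ ∘ u ≡ p₁ ∘ v → p₂ ∘ u ≡ p₂ ∘ v → u ≡ v
    jointly-monic u v e₁ e₂ =
      trans (mediator-unique e u refl refl) (sym (mediator-unique e v (sym e₁) (sym e₂)))
      where
      e : f ∘ (p₁ ∘ u) ≡ g ∘ (p₂ ∘ u)
      e = trans (sym assoc) (trans (cong (_∘ u) (proj₁ pb)) assoc)

  pullback-sym : ∀ {P A B Cc} {p₁ : P ⇒ A} {p₂ : P ⇒ B} {f : A ⇒ Cc} {g : B ⇒ Cc} →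
                 IsPullback C p₁ p₂ f g → IsPullback C p₂ p₁ g f
  pullback-sym pb = sym (proj₁ pb) , λ q₂ q₁ e →
    mediator pb q₁ q₂ (sym e) , mediator-p₂ pb (sym e) , mediator-p₁ pb (sym e) ,
    λ u e₂ e₁ → mediator-unique pb (sym e) u e₁ e₂

  pullback-resp : ∀ {P A B Cc} {p₁ : P ⇒ A} {p₂ p₂' : P ⇒ B} {f f' : A ⇒ Cc} {g : B ⇒ Cc} →
                  p₂ ≡ p₂' → f ≡ f' → IsPullback C p₁ p₂ f g → IsPullback C p₁ p₂' f' g
  pullback-resp refl refl pb = pb

  pullback-pasting : ∀ {P Q A A' B Cc} {r₁ : Q ⇒ A} {r₂ : Q ⇒ B} {f : A ⇒ Cc} {g : B ⇒ Cc}
                     {k : A' ⇒ A} {s₁ : P ⇒ Q} {s₂ : P ⇒ A'} →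
                     IsPullback C r₁ r₂ f g → r₁ ∘ s₁ ≡ k ∘ s₂ →
                     IsPullback C s₂ (r₂ ∘ s₁) (f ∘ k) g → IsPullback C s₁ s₂ r₁ k
  pullback-pasting {r₁ = r₁} {r₂} {f} {g} {k} {s₁} {s₂} right left outer =
    left , λ x y e →
      let outer-eq : (f ∘ k) ∘ y ≡ g ∘ (r₂ ∘ x)
          outer-eq = begin
            (f ∘ k) ∘ y    ≡⟨ assoc ⟩
            f ∘ (k ∘ y)    ≡⟨ cong (f ∘_) (sym e) ⟩
            f ∘ (r₁ ∘ x)   ≡⟨ sym assoc ⟩
            (f ∘ r₁) ∘ x   ≡⟨ cong (_∘ x) (proj₁ right) ⟩
            (g ∘ r₂) ∘ x   ≡⟨ assoc ⟩
            g ∘ (r₂ ∘ x)   ∎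
          u = mediator outer y (r₂ ∘ x) outer-eq
          s₁u≡x : s₁ ∘ u ≡ x
          s₁u≡x = jointly-monic right (s₁ ∘ u) x
            (trans (pullˡ u left) (trans assoc (trans (cong (k ∘_) (mediator-p₁ outer outer-eq)) (sym e))))
            (trans (sym assoc) (mediator-p₂ outer outer-eq))
      in u , s₁u≡x , mediator-p₁ outer outer-eq ,
         λ u' e₁ e₂ → mediator-unique outer outer-eq u' e₂ (trans assoc (cong (r₂ ∘_) e₁))

module Restrictions {o ℓ oj ℓj : Level} {C : Category o ℓ} {J : Category oj ℓj}
                    (𝓤 : Functor J C) {U : Category.Obj C}
                    (φ : ∀ i → Category._⇒_ C (Functor.F₀ 𝓤 i) U) where
  open Category C
  open Functor
  open NatTrans
  open PullbackFacts C
  private module J = Category J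

  record Restriction {A : Obj} (f : A ⇒ U) : Set (oj ⊔ ℓj ⊔ o ⊔ ℓ) where
    field
      diagram  : Functor J C
      cocone   : ∀ i → F₀ diagram i ⇒ A
      toBase   : NatTrans diagram 𝓤
      pullback : ∀ i → IsPullback C (cocone i) (η toBase i) f (φ i)
      cocone-commutes : IsCocone diagram A cocone

  open Restriction

  restrict : HasPullbacks C → IsCocone 𝓤 U φ → ∀ {A} (f : A ⇒ U) → Restriction f
  restrict has-pb φ-cocone {A} f = record
    { diagram = 𝓐 ; cocone = leg ; pullback = chosen
    ; toBase = record { η = proj ; commute = λ h → sym (mediator-p₂ (chosen _) (action-eq h)) }
    ; cocone-commutes = λ h → mediator-p₁ (chosen _) (action-eq h) }
    where
    P : J.Obj → Obj
    P i = proj₁ (has-pb f (φ i))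
    leg : ∀ i → P i ⇒ A
    leg i = proj₁ (proj₂ (has-pb f (φ i)))
    proj : ∀ i → P i ⇒ F₀ 𝓤 i
    proj i = proj₁ (proj₂ (proj₂ (has-pb f (φ i))))
    chosen : ∀ i → IsPullback C (leg i) (proj i) f (φ i)
    chosen i = proj₂ (proj₂ (proj₂ (has-pb f (φ i))))

    action-eq : ∀ {i j} (h : i J.⇒ j) → f ∘ leg i ≡ φ j ∘ (F₁ 𝓤 h ∘ proj i)
    action-eq {i} h = trans (proj₁ (chosen i)) (sym (pullˡ (proj i) (φ-cocone h)))

    action : ∀ {i j} → i J.⇒ j → P i ⇒ P j
    action {i} {j} h = mediator (chosen j) (leg i) (F₁ 𝓤 h ∘ proj i) (action-eq h)

    action-id : ∀ {i} → action (J.id {i}) ≡ id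
    action-id {i} = jointly-monic (chosen i) _ _
      (trans (mediator-p₁ (chosen i) (action-eq J.id)) (sym identityʳ))
      (trans (mediator-p₂ (chosen i) (action-eq J.id))
        (trans (cong (_∘ proj i) (identity 𝓤)) (trans identityˡ (sym identityʳ))))

    action-∘ : ∀ {i j k} {g : i J.⇒ j} {h : j J.⇒ k} → action (h J.∘ g) ≡ action h ∘ action g
    action-∘ {i} {j} {k} {g} {h} = jointly-monic (chosen k) _ _
      (trans (mediator-p₁ (chosen k) (action-eq (h J.∘ g)))
        (sym (trans (pullˡ (action g) (mediator-p₁ (chosen k) (action-eq h)))
                    (mediator-p₁ (chosen j) (action-eq g)))))
      (trans (mediator-p₂ (chosen k) (action-eq (h J.∘ g)))
        (trans (cong (_∘ proj i) (homomorphism 𝓤))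
          (sym (paste (mediator-p₂ (chosen k) (action-eq h)) (mediator-p₂ (chosen j) (action-eq g))))))

    𝓐 : Functor J C
    𝓐 = record { F₀ = P ; F₁ = action ; identity = action-id ; homomorphism = action-∘ }

  -- The transformation of a restriction to 𝓤 is cartesian: each naturality
  -- square is the left part of a rectangle whose right part and outer part
  -- are the pullbacks of φⱼ and φᵢ along f.
  toBase-cartesian : IsCocone 𝓤 U φ → ∀ {A} {f : A ⇒ U} (R : Restriction f) → Cartesian (toBase R)
  toBase-cartesian φ-cocone R {i} {j} h =
    pullback-pasting (pullback-sym (pullback R j)) (sym (commute (toBase R) h))
      (pullback-resp (sym (cocone-commutes R h)) (sym (φ-cocone h)) (pullback-sym (pullback R i)))

  restriction-colimit : IsPullbackStableColimit 𝓤 U φ →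
                        ∀ {A} {f : A ⇒ U} (R : Restriction f) → IsColimit (diagram R) A (cocone R)
  restriction-colimit φ-stable {f = f} R =
    proj₂ φ-stable (diagram R) (toBase R) (toBase-cartesian (proj₁ (proj₁ φ-stable)) R)
      _ (cocone R) (cocone-commutes R) f (pullback R)

  module _ {A B : Obj} {fA : A ⇒ U} {fB : B ⇒ U} (RA : Restriction fA) (RB : Restriction fB)
           (g : A ⇒ B) (over : fB ∘ g ≡ fA) where

    private
      induced-eq : ∀ i → fB ∘ (g ∘ cocone RA i) ≡ φ i ∘ η (toBase RA) i
      induced-eq i = trans (pullˡ (cocone RA i) over) (proj₁ (pullback RA i))

      component : ∀ i → F₀ (diagram RA) i ⇒ F₀ (diagram RB) i
      component i = mediator (pullback RB i) (g ∘ cocone RA i) (η (toBase RA) i) (induced-eq i)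

    induced-cocone : ∀ i → cocone RB i ∘ component i ≡ g ∘ cocone RA i
    induced-cocone i = mediator-p₁ (pullback RB i) (induced-eq i)

    induced-toBase : ∀ i → η (toBase RB) i ∘ component i ≡ η (toBase RA) i
    induced-toBase i = mediator-p₂ (pullback RB i) (induced-eq i)

    induced : NatTrans (diagram RA) (diagram RB)
    induced = record { η = component ; commute = naturality }
      where
      naturality : ∀ {i j} (h : i J.⇒ j) →
                   F₁ (diagram RB) h ∘ component i ≡ component j ∘ F₁ (diagram RA) h
      naturality {i} {j} h = jointly-monic (pullback RB j) _ _
        (trans (pullˡ (component i) (cocone-commutes RB h))
          (trans (induced-cocone i)
            (sym (trans (pullˡ (F₁ (diagram RA) h) (induced-cocone j))
                        (trans assoc (cong (g ∘_) (cocone-commutes RA h)))))))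
        (trans (pullˡ (component i) (sym (commute (toBase RB) h)))
          (trans assoc (trans (cong (F₁ 𝓤 h ∘_) (induced-toBase i))
            (sym (trans (pullˡ (F₁ (diagram RA) h) (induced-toBase j)) (sym (commute (toBase RA) h)))))))

    induced-pullback : ∀ i → IsPullback C (component i) (cocone RA i) (cocone RB i) g
    induced-pullback i =
      pullback-pasting (pullback RB i) (induced-cocone i)
        (pullback-resp (sym (induced-toBase i)) (sym over) (pullback RA i))

  induced-square : ∀ {A B B' D} {fA : A ⇒ U} {fB : B ⇒ U} {fB' : B' ⇒ U} {fD : D ⇒ U}
    (RA : Restriction fA) (RB : Restriction fB) (RB' : Restriction fB') (RD : Restriction fD)
    {g₁ : A ⇒ B} {g₂ : B ⇒ D} {g₃ : A ⇒ B'} {g₄ : B' ⇒ D}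
    (o₁ : fB ∘ g₁ ≡ fA) (o₂ : fD ∘ g₂ ≡ fB) (o₃ : fB' ∘ g₃ ≡ fA) (o₄ : fD ∘ g₄ ≡ fB') →
    g₂ ∘ g₁ ≡ g₄ ∘ g₃ →
    ∀ i → η (induced RB RD g₂ o₂) i ∘ η (induced RA RB g₁ o₁) i
        ≡ η (induced RB' RD g₄ o₄) i ∘ η (induced RA RB' g₃ o₃) i
  induced-square RA RB RB' RD o₁ o₂ o₃ o₄ sq i = jointly-monic (pullback RD i) _ _
    (trans (paste (induced-cocone RB RD _ o₂ i) (induced-cocone RA RB _ o₁ i))
      (trans (cong (_∘ cocone RA i) sq)
        (sym (paste (induced-cocone RB' RD _ o₄ i) (induced-cocone RA RB' _ o₃ i)))))
    (trans (pullˡ _ (induced-toBase RB RD _ o₂ i))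
      (trans (induced-toBase RA RB _ o₁ i)
        (sym (trans (pullˡ _ (induced-toBase RB' RD _ o₄ i)) (induced-toBase RA RB' _ o₃ i)))))

-- Every vertex of D maps to U through w or t,
-- every arrow of D lies over U, so the construction above applies vertex- and
-- arrow-wise; the result is a double square in [J, C] whose components are
-- pullback liftings of D.
module RestrictedDoubleSquare {o ℓ oj ℓj : Level} {C : Category o ℓ} {J : Category oj ℓj}
  (𝓤 : Functor J C) {U : Category.Obj C} (φ : ∀ i → Category._⇒_ C (Functor.F₀ 𝓤 i) U)
  (has-pb : HasPullbacks C) (φ-cocone : IsCocone 𝓤 U φ)
  (D : DSq C) (D-commutes : Commutes C D)
  (w : Category._⇒_ C (DSq.X D) U) (t : Category._⇒_ C (DSq.Z D) U)
  (cospan : Category._∘_ C w (DSq.c D) ≡ Category._∘_ C t (DSq.d D))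
  (RX : Restrictions.Restriction 𝓤 φ w) where
  open Category C
  open DSq D
  open Restrictions 𝓤 φ
  open Restriction
  open NatTrans
  open ≡-Reasoning

  RL : Restriction (w ∘ m)
  RL = restrict has-pb φ-cocone (w ∘ m)
  RK : Restriction ((w ∘ m) ∘ a)
  RK = restrict has-pb φ-cocone ((w ∘ m) ∘ a)
  RR : Restriction (t ∘ n)
  RR = restrict has-pb φ-cocone (t ∘ n)
  RY : Restriction (w ∘ c)
  RY = restrict has-pb φ-cocone (w ∘ c)
  RZ : Restriction t
  RZ = restrict has-pb φ-cocone t

  -- The arrows j and b lie over U; this is where commutativity of D and of the cospan enter.
  j-over : (w ∘ c) ∘ j ≡ (w ∘ m) ∘ a
  j-over = begin
    (w ∘ c) ∘ j   ≡⟨ assoc ⟩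
    w ∘ (c ∘ j)   ≡⟨ cong (w ∘_) (sym (proj₁ D-commutes)) ⟩
    w ∘ (m ∘ a)   ≡⟨ sym assoc ⟩
    (w ∘ m) ∘ a   ∎

  b-over : (t ∘ n) ∘ b ≡ (w ∘ m) ∘ a
  b-over = begin
    (t ∘ n) ∘ b   ≡⟨ assoc ⟩
    t ∘ (n ∘ b)   ≡⟨ cong (t ∘_) (proj₂ D-commutes) ⟩
    t ∘ (d ∘ j)   ≡⟨ sym assoc ⟩
    (t ∘ d) ∘ j   ≡⟨ cong (_∘ j) (sym cospan) ⟩
    (w ∘ c) ∘ j   ≡⟨ j-over ⟩
    (w ∘ m) ∘ a   ∎

  α : NatTrans (diagram RK) (diagram RL)
  α = induced RK RL a refl
  β : NatTrans (diagram RK) (diagram RR)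
  β = induced RK RR b b-over
  γ : NatTrans (diagram RY) (diagram RX)
  γ = induced RY RX c refl
  δ : NatTrans (diagram RY) (diagram RZ)
  δ = induced RY RZ d (sym cospan)
  μ : NatTrans (diagram RL) (diagram RX)
  μ = induced RL RX m refl
  ι : NatTrans (diagram RK) (diagram RY)
  ι = induced RK RY j j-over
  ν : NatTrans (diagram RR) (diagram RZ)
  ν = induced RR RZ n refl

  comm₁ : ∀ i → η μ i ∘ η α i ≡ η γ i ∘ η ι i
  comm₁ = induced-square RK RL RY RX refl refl j-over refl (proj₁ D-commutes)

  comm₂ : ∀ i → η ν i ∘ η β i ≡ η δ i ∘ η ι i
  comm₂ = induced-square RK RR RY RZ b-over refl j-over (sym cospan) (proj₂ D-commutes)

  component : Category.Obj J → DSq C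
  component i = record
    { L = Functor.F₀ (diagram RL) i ; K = Functor.F₀ (diagram RK) i ; R = Functor.F₀ (diagram RR) i
    ; X = Functor.F₀ (diagram RX) i ; Y = Functor.F₀ (diagram RY) i ; Z = Functor.F₀ (diagram RZ) i
    ; a = η α i ; b = η β i ; c = η γ i ; d = η δ i ; m = η μ i ; j = η ι i ; n = η ν i }

  lifting : ∀ i → PullbackLifting C (component i) D
  lifting i = record
    { ψL = cocone RL i ; ψK = cocone RK i ; ψR = cocone RR i
    ; ψX = cocone RX i ; ψY = cocone RY i ; ψZ = cocone RZ i
    ; pb-a = induced-pullback RK RL a refl i
    ; pb-b = induced-pullback RK RR b b-over i
    ; pb-c = induced-pullback RY RX c refl i
    ; pb-d = induced-pullback RY RZ d (sym cospan) i
    ; pb-m = induced-pullback RL RX m refl i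
    ; pb-j = induced-pullback RK RY j j-over i
    ; pb-n = induced-pullback RR RZ n refl i }

-- The given colimit ξ is itself the restriction of φ along w; the other
-- restrictions are colimits by pullback stability of φ, the induced
-- transformations have the arrows of D as their colimit morphisms, and every
-- component lies in 𝔻 by pullback stability of 𝔻.
mainTheorem2 : ∀ {o ℓ ℓd oj ℓj : Level} (C : Category o ℓ) → HasPullbacks C →
    (𝔻 : DSApproach C ℓd) → PullbackStable C 𝔻 → SoundColimitDecomposition 𝔻 →
    (D : DSq C) → DSApproach.member 𝔻 D →
    (J : Category oj ℓj) (𝓧 : Functor J C) (ξ : ∀ i → Category._⇒_ C (Functor.F₀ 𝓧 i) (DSq.X D)) →
    IsColimit 𝓧 (DSq.X D) ξ →
    (U : Category.Obj C) (w : Category._⇒_ C (DSq.X D) U) (t : Category._⇒_ C (DSq.Z D) U) →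
    Category._∘_ C w (DSq.c D) ≡ Category._∘_ C t (DSq.d D) →
    (𝓤 : Functor J C) (φ : ∀ i → Category._⇒_ C (Functor.F₀ 𝓤 i) U) →
    IsPullbackStableColimit 𝓤 U φ →
    (ω : NatTrans 𝓧 𝓤) →
    (∀ i → IsPullback C (ξ i) (NatTrans.η ω i) w (φ i)) →
    Solution 𝔻 𝓧 ξ (DSq.a D) (DSq.b D) (DSq.m D)
mainTheorem2 C has-pb 𝔻 𝔻-stable _ D D∈𝔻 J 𝓧 ξ ξ-colim U w t cospan 𝓤 φ φ-stable ω ω-pullback =
  record
    { 𝓛 = diagram RL ; 𝓚 = diagram RK ; 𝓡 = diagram RR ; 𝓨 = diagram RY ; 𝓩 = diagram RZ
    ; α = α ; β = β ; γ = γ ; δ = δ ; μ = μ ; ι = ι ; ν = ν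
    ; λL = cocone RL ; λK = cocone RK ; λR = cocone RR
    ; λL-colim = restriction-colimit φ-stable RL
    ; λK-colim = restriction-colimit φ-stable RK
    ; λR-colim = restriction-colimit φ-stable RR
    ; 𝓨-colim = _ , _ , restriction-colimit φ-stable RY
    ; 𝓩-colim = _ , _ , restriction-colimit φ-stable RZ
    ; m-col = λ i → sym (induced-cocone RL RX (DSq.m D) refl i)
    ; a-col = λ i → sym (induced-cocone RK RL (DSq.a D) refl i)
    ; b-col = λ i → sym (induced-cocone RK RR (DSq.b D) b-over i)
    ; comm₁ = comm₁ ; comm₂ = comm₂
    ; components = λ i → 𝔻-stable (component i) D (comm₁ i , comm₂ i) (lifting i) D∈𝔻 }
  where
  open Restrictions 𝓤 φ
  open Restriction
  RX : Restriction w
  RX = record { diagram = 𝓧 ; cocone = ξ ; toBase = ω ; pullback = ω-pullback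
              ; cocone-commutes = proj₁ ξ-colim }
  open RestrictedDoubleSquare 𝓤 φ has-pb (proj₁ (proj₁ φ-stable)) D
         (DSApproach.commutative 𝔻 D D∈𝔻) w t cospan RX
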